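{- Let $X$ be a finite set, let $\phi$ be a closure operator on $X$ with the anti-exchange property, let $P_1,\dots,P_k\subseteq X$ be unary predicates, and let $\mathcal{S}(Y)=\{z\in X: P(z)\subseteq\bigcup_{y\in Y}P(y)\}$ where $P(z)=\{i: z\in P_i\}$. Let $\mathcal{C}_\phi$ be the family of $\phi$-closed sets. Assume that every $\mathcal{S}$-closed set is either $\phi$-closed or quasi-closed with respect to $\phi$, and in the latter case it has a one-element extension in $\mathcal{C}_\phi$ (i.e. $L\cup\{x\}\in\mathcal{C}_\phi$ for some $x\notin L$). Then the operator $\phi_{\mathcal{S}}(Y)=\phi(Y)\cap\mathcal{S}(Y)$ satisfies the anti-exchange property as well.
   Context: A closure operator on $X$ is an extensive, monotone, idempotent map $2^X\to2^X$; a set $Y$ is closed if it equals its closure. A closure operator $\psi$ has the anti-exchange property if for every $\psi$-closed $Y$ and distinct $x,y\in X\setminus Y$, $x\in\psi(Y\cup\{y\})$ implies $y\notin\psi(Y\cup\{x\})$. A subset $Y\subseteq X$ is quasi-closed with respect to $\phi$ if $Y\notin\mathcal{C}_\phi$ and for every $Z\in\mathcal{C}_\phi$, either $Z\cap Y\in\mathcal{C}_\phi$ or $Z\cap Y=Y$. -}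

module Defs where

open import Data.Nat using (ℕ)
open import Data.Fin using (Fin)
open import Data.Fin.Subset using (Subset; _∈_; _∉_; _⊆_; _∪_; _∩_; ⁅_⁆)
open import Data.Fin.Subset.Properties using (_∈?_; _⊆?_)
open import Data.Fin.Properties using (any?)
open import Data.Vec using (tabulate)
open import Data.Product using (Σ; _×_; _,_)
open import Data.Sum using (_⊎_)
open import Relation.Binary.PropositionalEquality using (_≡_; _≢_)
open import Relation.Nullary using (¬_; _×-dec_)
open import Relation.Nullary.Decidable using (⌊_⌋)

record IsClosureOperator {n : ℕ} (ψ : Subset n → Subset n) : Set where
  field
    extensive  : ∀ Y → Y ⊆ ψ Y
    monotone   : ∀ Y Z → Y ⊆ Z → ψ Y ⊆ ψ Z
    idempotent : ∀ Y → ψ (ψ Y) ≡ ψ Y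

Closed : {n : ℕ} → (Subset n → Subset n) → Subset n → Set
Closed ψ Y = ψ Y ≡ Y

AntiExchange : {n : ℕ} → (Subset n → Subset n) → Set
AntiExchange {n} ψ =
  ∀ (Y : Subset n) → Closed ψ Y →
  ∀ (x y : Fin n) → x ≢ y → x ∉ Y → y ∉ Y →
  x ∈ ψ (Y ∪ ⁅ y ⁆) → y ∉ ψ (Y ∪ ⁅ x ⁆)

QuasiClosed : {n : ℕ} → (Subset n → Subset n) → Subset n → Set
QuasiClosed {n} φ Y =
  ¬ Closed φ Y × (∀ (Z : Subset n) → Closed φ Z → Closed φ (Z ∩ Y) ⊎ Z ∩ Y ≡ Y)

Pof : {n k : ℕ} → (Fin k → Subset n) → Fin n → Subset k
Pof P z = tabulate (λ i → ⌊ z ∈? P i ⌋)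

⋃P : {n k : ℕ} → (Fin k → Subset n) → Subset n → Subset k
⋃P P Y = tabulate (λ i → ⌊ any? (λ y → (y ∈? Y) ×-dec (i ∈? Pof P y)) ⌋)

𝒮 : {n k : ℕ} → (Fin k → Subset n) → Subset n → Subset n
𝒮 P Y = tabulate (λ z → ⌊ Pof P z ⊆? ⋃P P Y ⌋)

φ𝒮 : {n k : ℕ} → (Subset n → Subset n) → (Fin k → Subset n) → Subset n → Subset n
φ𝒮 φ P Y = φ Y ∩ 𝒮 P Y

{-# OPTIONS --safe #-}
-- For a φ𝒮-closed Y, the set L = 𝒮(Y) is 𝒮-closed and Y = φ(Y) ∩ L. If L is φ-closed, so
-- is Y; if L is quasi-closed, then φ(Y) ∩ L is φ-closed (so Y is) or L = Y, and then the
-- one-point extension Y ∪ {w} is φ-closed. Either way φ(Y) ⊆ Y ∪ {w}. Anti-exchange for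
-- such a Y reduces to anti-exchange of φ at the closed set φ(Y), since adjoining a point
-- to Y or to φ(Y) has the same φ-closure; a point of φ(Y) ∖ Y can only be w.
module Submission where

open import Defs
open import Data.Nat using (ℕ)
open import Data.Fin using (Fin)
open import Data.Fin.Subset using (Subset; _∈_; _∉_; _⊆_; _∪_; _∩_; ⁅_⁆)
open import Data.Fin.Subset.Properties
  using (_∈?_; _⊆?_; ⊆-antisym; p⊆p∪q; q⊆p∪q; x∈p∪q⁻; x∈p∩q⁺; x∈p∩q⁻; p∩q⊆p; p∩q⊆q;
         x∈⁅y⁆⇒x≡y)
open import Data.Fin.Properties using (any?)
open import Data.Vec using (tabulate)
open import Data.Vec.Properties using (lookup∘tabulate; []=⇒lookup; lookup⇒[]=)
open import Data.Bool.Properties using (T-≡)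
open import Data.Product using (Σ; _×_; _,_; proj₁; proj₂)
open import Data.Sum using (_⊎_; inj₁; inj₂; [_,_])
open import Function.Bundles using (Equivalence)
open import Relation.Nullary using (Dec; yes; no; _×-dec_; contradiction)
open import Relation.Nullary.Decidable using (⌊_⌋; toWitness; fromWitness)
open import Relation.Binary.PropositionalEquality
  using (_≡_; _≢_; sym; trans; subst)

∈-tabulate⁻ : ∀ {m} {Q : Fin m → Set} (d : ∀ i → Dec (Q i)) {x : Fin m} →
              x ∈ tabulate (λ i → ⌊ d i ⌋) → Q x
∈-tabulate⁻ d {x} x∈ =
  toWitness (Equivalence.from T-≡ (trans (sym (lookup∘tabulate _ x)) ([]=⇒lookup x∈)))

∈-tabulate⁺ : ∀ {m} {Q : Fin m → Set} (d : ∀ i → Dec (Q i)) {x : Fin m} →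
              Q x → x ∈ tabulate (λ i → ⌊ d i ⌋)
∈-tabulate⁺ d {x} q =
  lookup⇒[]= x _ (trans (lookup∘tabulate _ x) (Equivalence.to T-≡ (fromWitness q)))

∈-∪-⁅⁆⁻ : ∀ {n} {Y : Subset n} {w z : Fin n} → z ∈ Y ∪ ⁅ w ⁆ → z ∉ Y → z ≡ w
∈-∪-⁅⁆⁻ {Y = Y} {w} z∈ z∉Y with x∈p∪q⁻ Y ⁅ w ⁆ z∈
... | inj₁ z∈Y = contradiction z∈Y z∉Y
... | inj₂ z∈w = x∈⁅y⁆⇒x≡y w z∈w

module SupportClosure {n k : ℕ} (P : Fin k → Subset n) where

  ∈-⋃P⁻ : ∀ {Y i} → i ∈ ⋃P P Y → Σ (Fin n) λ y → y ∈ Y × i ∈ Pof P y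
  ∈-⋃P⁻ {Y} = ∈-tabulate⁻ (λ i → any? (λ y → (y ∈? Y) ×-dec (i ∈? Pof P y)))

  ∈-⋃P⁺ : ∀ {Y i} y → y ∈ Y → i ∈ Pof P y → i ∈ ⋃P P Y
  ∈-⋃P⁺ {Y} y y∈Y i∈Py =
    ∈-tabulate⁺ (λ i → any? (λ y → (y ∈? Y) ×-dec (i ∈? Pof P y))) (y , y∈Y , i∈Py)

  ∈-𝒮⁻ : ∀ {Y z} → z ∈ 𝒮 P Y → Pof P z ⊆ ⋃P P Y
  ∈-𝒮⁻ {Y} = ∈-tabulate⁻ (λ z → Pof P z ⊆? ⋃P P Y)

  ∈-𝒮⁺ : ∀ {Y z} → Pof P z ⊆ ⋃P P Y → z ∈ 𝒮 P Y
  ∈-𝒮⁺ {Y} = ∈-tabulate⁺ (λ z → Pof P z ⊆? ⋃P P Y)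

  𝒮-extensive : ∀ Y → Y ⊆ 𝒮 P Y
  𝒮-extensive Y {y} y∈Y = ∈-𝒮⁺ (∈-⋃P⁺ y y∈Y)

  ⋃P-𝒮 : ∀ Y → ⋃P P (𝒮 P Y) ⊆ ⋃P P Y
  ⋃P-𝒮 Y i∈ with ∈-⋃P⁻ i∈
  ... | y , y∈𝒮Y , i∈Py = ∈-𝒮⁻ y∈𝒮Y i∈Py

  𝒮-closed : ∀ Y → Closed (𝒮 P) (𝒮 P Y)
  𝒮-closed Y = ⊆-antisym (λ z∈ → ∈-𝒮⁺ (λ i∈ → ⋃P-𝒮 Y (∈-𝒮⁻ z∈ i∈))) (𝒮-extensive (𝒮 P Y))

module ClosureOperator {n : ℕ} {φ : Subset n → Subset n} (cl : IsClosureOperator φ) where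
  open IsClosureOperator cl

  closed-⊆ : ∀ {Y Z} → Closed φ Z → Y ⊆ Z → φ Y ⊆ Z
  closed-⊆ {Y} {Z} cZ Y⊆Z z∈ = subst (_ ∈_) cZ (monotone Y Z Y⊆Z z∈)

  closed-∩ : ∀ {A B} → Closed φ A → Closed φ B → Closed φ (A ∩ B)
  closed-∩ {A} {B} cA cB = ⊆-antisym
    (λ z∈ → x∈p∩q⁺ (closed-⊆ cA (p∩q⊆p A B) z∈ , closed-⊆ cB (p∩q⊆q A B) z∈))
    (extensive (A ∩ B))

  φ-φ∪ : ∀ Y A → φ (φ Y ∪ A) ≡ φ (Y ∪ A)
  φ-φ∪ Y A = ⊆-antisym (closed-⊆ (idempotent (Y ∪ A)) φY∪A⊆) (monotone _ _ Y∪A⊆)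
    where
    φY∪A⊆ : φ Y ∪ A ⊆ φ (Y ∪ A)
    φY∪A⊆ z∈ with x∈p∪q⁻ (φ Y) A z∈
    ... | inj₁ z∈φY = monotone Y (Y ∪ A) (p⊆p∪q A) z∈φY
    ... | inj₂ z∈A  = extensive (Y ∪ A) (q⊆p∪q Y A z∈A)
    Y∪A⊆ : Y ∪ A ⊆ φ Y ∪ A
    Y∪A⊆ z∈ with x∈p∪q⁻ Y A z∈
    ... | inj₁ z∈Y = p⊆p∪q A (extensive Y z∈Y)
    ... | inj₂ z∈A = q⊆p∪q (φ Y) A z∈A

  φ-∪-⁅⁆-absorb : ∀ {Y x} → x ∈ φ Y → φ (Y ∪ ⁅ x ⁆) ≡ φ Y
  φ-∪-⁅⁆-absorb {Y} {x} x∈φY = ⊆-antisym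
    (closed-⊆ (idempotent Y) (λ z∈ → [ extensive Y , ∈⁅x⁆⇒∈φY ] (x∈p∪q⁻ Y ⁅ x ⁆ z∈)))
    (monotone Y (Y ∪ ⁅ x ⁆) (p⊆p∪q ⁅ x ⁆))
    where
    ∈⁅x⁆⇒∈φY : ∀ {z} → z ∈ ⁅ x ⁆ → z ∈ φ Y
    ∈⁅x⁆⇒∈φY z∈x = subst (_∈ φ Y) (sym (x∈⁅y⁆⇒x≡y x z∈x)) x∈φY

  antiExchange-outside-closure :
    AntiExchange φ → ∀ Y (x y : Fin n) → x ≢ y → x ∉ φ Y → y ∉ φ Y →
    x ∈ φ (Y ∪ ⁅ y ⁆) → y ∉ φ (Y ∪ ⁅ x ⁆)
  antiExchange-outside-closure ae Y x y x≢y x∉ y∉ x∈ y∈ =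
    ae (φ Y) (idempotent Y) x y x≢y x∉ y∉
       (subst (x ∈_) (sym (φ-φ∪ Y ⁅ y ⁆)) x∈)
       (subst (y ∈_) (sym (φ-φ∪ Y ⁅ x ⁆)) y∈)

  antiExchange-one-point-gap :
    AntiExchange φ → ∀ {Y w} → φ Y ⊆ Y ∪ ⁅ w ⁆ →
    ∀ (x y : Fin n) → x ≢ y → x ∉ Y → y ∉ Y →
    x ∈ φ (Y ∪ ⁅ y ⁆) → y ∉ φ (Y ∪ ⁅ x ⁆)
  antiExchange-one-point-gap ae {Y} gap x y x≢y x∉Y y∉Y x∈ y∈
    with x ∈? φ Y | y ∈? φ Y
  ... | yes x∈φY | _ =
    x≢y (trans (∈-∪-⁅⁆⁻ (gap x∈φY) x∉Y)
               (sym (∈-∪-⁅⁆⁻ (gap (subst (y ∈_) (φ-∪-⁅⁆-absorb x∈φY) y∈)) y∉Y)))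
  ... | no _ | yes y∈φY =
    x≢y (trans (∈-∪-⁅⁆⁻ (gap (subst (x ∈_) (φ-∪-⁅⁆-absorb y∈φY) x∈)) x∉Y)
               (sym (∈-∪-⁅⁆⁻ (gap y∈φY) y∉Y)))
  ... | no x∉φY | no y∉φY = antiExchange-outside-closure ae Y x y x≢y x∉φY y∉φY x∈ y∈

  closed-or-one-point-extension :
    ∀ {L Y} → Closed φ L ⊎ (QuasiClosed φ L × Σ (Fin n) (λ w → w ∉ L × Closed φ (L ∪ ⁅ w ⁆))) →
    φ Y ∩ L ≡ Y → Closed φ Y ⊎ Σ (Fin n) (λ w → Closed φ (Y ∪ ⁅ w ⁆))
  closed-or-one-point-extension {L} {Y} (inj₁ cL) Y≡ =
    inj₁ (subst (Closed φ) Y≡ (closed-∩ (idempotent Y) cL))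
  closed-or-one-point-extension {L} {Y} (inj₂ ((_ , meets) , w , _ , cL∪w)) Y≡
    with meets (φ Y) (idempotent Y)
  ... | inj₁ c  = inj₁ (subst (Closed φ) Y≡ c)
  ... | inj₂ L≡ = inj₂ (w , subst (λ Z → Closed φ (Z ∪ ⁅ w ⁆)) (trans (sym L≡) Y≡) cL∪w)

lemma7p7 : (n k : ℕ) (φ : Subset n → Subset n) (P : Fin k → Subset n) →
    IsClosureOperator φ → AntiExchange φ →
    (∀ (L : Subset n) → Closed (𝒮 P) L →
      Closed φ L ⊎ (QuasiClosed φ L × Σ (Fin n) (λ x → x ∉ L × Closed φ (L ∪ ⁅ x ⁆)))) →
    AntiExchange (φ𝒮 φ P)
lemma7p7 n k φ P cl ae hyp Y cY x y x≢y x∉Y y∉Y x∈ y∈ =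
  antiExchange-one-point-gap ae (proj₂ gap) x y x≢y x∉Y y∉Y
    (proj₁ (x∈p∩q⁻ _ _ x∈)) (proj₁ (x∈p∩q⁻ _ _ y∈))
  where
  open ClosureOperator cl
  open SupportClosure P

  gap : Σ (Fin n) λ w → φ Y ⊆ Y ∪ ⁅ w ⁆
  gap with closed-or-one-point-extension (hyp (𝒮 P Y) (𝒮-closed Y)) cY
  ... | inj₁ cY′      = x , λ z∈ → p⊆p∪q ⁅ x ⁆ (subst (_ ∈_) cY′ z∈)
  ... | inj₂ (w , c) = w , closed-⊆ c (p⊆p∪q ⁅ w ⁆)
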